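{- Let $O=(0,0,0)$. Every equilateral triangle $OAB$ with $A,B\in\mathbb{Z}^3$ lying in the plane $\{(\alpha,\beta,\gamma):\alpha+\beta+\gamma=0\}$ satisfies $\{A,B\}=\{(m,-n,n-m),\,(m-n,-m,n)\}$ for some integers $m,n$, and its side length is $\sqrt{2(m^2-mn+n^2)}$. -}

module Defs where

open import Data.Integer using (ℤ; _+_; _-_; _*_; -_; +_)
open import Data.Product using (_×_; _,_)
open import Relation.Binary.PropositionalEquality using (_≡_)

record Point : Set where
  constructor ⟨_,_,_⟩
  field
    x y z : ℤ

O : Point
O = ⟨ + 0 , + 0 , + 0 ⟩

InPlane : Point → Set
InPlane ⟨ a , b , c ⟩ = a + b + c ≡ + 0

dist² : Point → Point → ℤ
dist² ⟨ a , b , c ⟩ ⟨ a' , b' , c' ⟩ =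
  (a - a') * (a - a') + (b - b') * (b - b') + (c - c') * (c - c')

Equilateral : Point → Point → Point → Set
Equilateral P A B = dist² P A ≡ dist² P B × dist² P A ≡ dist² A B

{-# OPTIONS --safe #-}
module Submission where

-- Let ρ be the rotation by π/3 about the axis (1, 1, 1); it preserves the plane
-- α + β + γ = 0. For A, B in that plane with squared sides p = |OA|², q = |OB|²,
-- r = |AB|² there is the polynomial identity
--   |B − ρA|² · |A − ρB|² = p² + q² + r² − pq − qr − rp,
-- whose right-hand side vanishes when p = q = r. Hence B = ρA or A = ρB, and
-- writing A = (m, −n, n − m) gives ρA = (m − n, −m, n) and |OA|² = 2(m² − mn + n²).

open import Defs
open import Data.Integer using (ℤ; _+_; _-_; _*_; -_; +_; -[1+_]; 0ℤ; ∣_∣)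
open import Data.Integer.Properties
  using (+-injective; pos-+; pos-*; neg-involutive; +-identityˡ; *-cancelˡ-≡;
         i*j≡0⇒i≡0∨j≡0; ∣i∣≡0⇒i≡0; i-j≡0⇒i≡j)
open import Data.Integer.Solver using (module +-*-Solver)
open import Data.Integer.Tactic.RingSolver using (solve-∀)
import Data.Nat as ℕ
import Data.Nat.Properties as ℕ
open import Data.Product using (_×_; _,_; ∃₂; proj₁)
open import Data.Sum using (_⊎_; inj₁; inj₂; reduce)
import Data.Sum as Sum
open import Function using (_∘_)
open import Relation.Binary.PropositionalEquality
  using (_≡_; _≢_; refl; sym; trans; cong; cong₂; module ≡-Reasoning)

neg-minus : ∀ i j → - (i - j) ≡ j - i
neg-minus = solve-∀

i-[i-j]≡j : ∀ i j → i - (i - j) ≡ j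
i-[i-j]≡j = solve-∀

i+j+k≡0⇒k≡-j-i : ∀ i j k → i + j + k ≡ 0ℤ → k ≡ - j - i
i+j+k≡0⇒k≡-j-i i j k i+j+k≡0 = begin
  k                     ≡⟨ rearrange i j k ⟩
  i + j + k + (- j - i) ≡⟨ cong (_+ (- j - i)) i+j+k≡0 ⟩
  0ℤ + (- j - i)        ≡⟨ +-identityˡ _ ⟩
  - j - i               ∎
  where
  open ≡-Reasoning
  rearrange : ∀ i j k → k ≡ i + j + k + (- j - i)
  rearrange = solve-∀

i*i≡+∣i∣*∣i∣ : ∀ i → i * i ≡ + (∣ i ∣ ℕ.* ∣ i ∣)
i*i≡+∣i∣*∣i∣ (+ n)     = sym (pos-* n n)
i*i≡+∣i∣*∣i∣ -[1+ n ] = refl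

sum-of-squares≡0 : ∀ i j k → i * i + j * j + k * k ≡ 0ℤ → i ≡ 0ℤ × j ≡ 0ℤ × k ≡ 0ℤ
sum-of-squares≡0 i j k sum≡0 = square≡0 i I≡0 , square≡0 j J≡0 , square≡0 k K≡0
  where
  open ≡-Reasoning
  square≡0 : ∀ i → ∣ i ∣ ℕ.* ∣ i ∣ ≡ 0 → i ≡ 0ℤ
  square≡0 i = ∣i∣≡0⇒i≡0 ∘ reduce ∘ ℕ.m*n≡0⇒m≡0∨n≡0 ∣ i ∣
  I J K : ℕ.ℕ
  I = ∣ i ∣ ℕ.* ∣ i ∣
  J = ∣ j ∣ ℕ.* ∣ j ∣
  K = ∣ k ∣ ℕ.* ∣ k ∣
  I+J+K≡0 : I ℕ.+ J ℕ.+ K ≡ 0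
  I+J+K≡0 = +-injective (begin
    + (I ℕ.+ J ℕ.+ K)     ≡⟨ pos-+ (I ℕ.+ J) K ⟩
    + (I ℕ.+ J) + + K     ≡⟨ cong (_+ + K) (pos-+ I J) ⟩
    + I + + J + + K       ≡⟨ cong₂ _+_ (cong₂ _+_ (i*i≡+∣i∣*∣i∣ i) (i*i≡+∣i∣*∣i∣ j)) (i*i≡+∣i∣*∣i∣ k) ⟨
    i * i + j * j + k * k ≡⟨ sum≡0 ⟩
    0ℤ                    ∎)
  I+J≡0 : I ℕ.+ J ≡ 0
  I+J≡0 = ℕ.m+n≡0⇒m≡0 (I ℕ.+ J) I+J+K≡0
  I≡0 : I ≡ 0
  I≡0 = ℕ.m+n≡0⇒m≡0 I I+J≡0
  J≡0 : J ≡ 0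
  J≡0 = ℕ.m+n≡0⇒n≡0 I I+J≡0
  K≡0 : K ≡ 0
  K≡0 = ℕ.m+n≡0⇒n≡0 (I ℕ.+ J) I+J+K≡0

-- ρ: the cyclic shift of coordinates (rotation by 2π/3) composed with the point
-- reflection in O (rotation by π inside the plane).
rotate : Point → Point
rotate ⟨ x , y , z ⟩ = ⟨ - z , - x , - y ⟩

planar : ℤ → ℤ → Point
planar m n = ⟨ m , - n , n - m ⟩

norm : ℤ → ℤ → ℤ
norm m n = m * m - m * n + n * n

sideDefect : ℤ → ℤ → ℤ → ℤ
sideDefect p q r = p * p + q * q + r * r - p * q - q * r - r * p

InPlane⇒planar : ∀ P → InPlane P → ∃₂ λ m n → P ≡ planar m n
InPlane⇒planar ⟨ x , y , z ⟩ x+y+z≡0 =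
  x , - y , cong₂ ⟨ x ,_,_⟩ (sym (neg-involutive y)) (i+j+k≡0⇒k≡-j-i x y z x+y+z≡0)

rotate-planar : ∀ m n → rotate (planar m n) ≡ ⟨ m - n , - m , n ⟩
rotate-planar m n = cong₂ (λ x z → ⟨ x , - m , z ⟩) (neg-minus n m) (neg-involutive n)

-- The ring solvers do not unfold definitions, so the identities below are
-- restated with dist², planar, norm and sideDefect expanded.
dist²-O-planar : ∀ m n → dist² O (planar m n) ≡ + 2 * norm m n
dist²-O-planar m n = expanded m n
  where
  expanded : ∀ m n → (0ℤ - m) * (0ℤ - m) + (0ℤ - - n) * (0ℤ - - n) + (0ℤ - (n - m)) * (0ℤ - (n - m))
                   ≡ + 2 * (m * m - m * n + n * n)
  expanded = solve-∀

dist²-planar : ∀ a b c d → dist² (planar a b) (planar c d) ≡ + 2 * norm (a - c) (b - d)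
dist²-planar a b c d = expanded a b c d
  where
  expanded : ∀ a b c d →
    (a - c) * (a - c) + (- b - - d) * (- b - - d) + (b - a - (d - c)) * (b - a - (d - c))
      ≡ + 2 * ((a - c) * (a - c) - (a - c) * (b - d) + (b - d) * (b - d))
  expanded = solve-∀

-- The identity of the header divided by 4 and written in the coordinates of
-- planar, where ρ (planar m n) = planar (m − n) m.
norm-rotation-identity : ∀ m n m′ n′ →
  norm (m′ - (m - n)) (n′ - m) * norm (m - (m′ - n′)) (n - m′)
    ≡ sideDefect (norm m n) (norm m′ n′) (norm (m - m′) (n - n′))
norm-rotation-identity = solve 4 (λ m n m′ n′ →
    norm′ (m′ :- (m :- n)) (n′ :- m) :* norm′ (m :- (m′ :- n′)) (n :- m′)
      := sideDefect′ (norm′ m n) (norm′ m′ n′) (norm′ (m :- m′) (n :- n′))) refl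
  where
  open +-*-Solver
  norm′ : ∀ {k} → Polynomial k → Polynomial k → Polynomial k
  norm′ x y = x :* x :- x :* y :+ y :* y
  sideDefect′ : ∀ {k} → Polynomial k → Polynomial k → Polynomial k → Polynomial k
  sideDefect′ p q r = p :* p :+ q :* q :+ r :* r :- p :* q :- q :* r :- r :* p

sideDefect-equal : ∀ p → sideDefect p p p ≡ 0ℤ
sideDefect-equal p = expanded p
  where
  expanded : ∀ p → p * p + p * p + p * p - p * p - p * p - p * p ≡ 0ℤ
  expanded = solve-∀

dist²≡0⇒≡ : ∀ P Q → dist² P Q ≡ 0ℤ → P ≡ Q
dist²≡0⇒≡ ⟨ a , b , c ⟩ ⟨ a′ , b′ , c′ ⟩ dist²≡0
  with sum-of-squares≡0 (a - a′) (b - b′) (c - c′) dist²≡0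
... | a-a′≡0 , b-b′≡0 , c-c′≡0
  with i-j≡0⇒i≡j a a′ a-a′≡0 | i-j≡0⇒i≡j b b′ b-b′≡0 | i-j≡0⇒i≡j c c′ c-c′≡0
... | refl | refl | refl = refl

norm≡0⇒rotation : ∀ m n m′ n′ → norm (m′ - (m - n)) (n′ - m) ≡ 0ℤ →
                   planar m′ n′ ≡ rotate (planar m n)
norm≡0⇒rotation m n m′ n′ norm≡0 = begin
  planar m′ n′        ≡⟨ dist²≡0⇒≡ _ _ (trans (dist²-planar m′ n′ (m - n) m) (cong (+ 2 *_) norm≡0)) ⟩
  planar (m - n) m    ≡⟨ cong ⟨ m - n , - m ,_⟩ (i-[i-j]≡j m n) ⟩
  ⟨ m - n , - m , n ⟩ ≡⟨ rotate-planar m n ⟨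
  rotate (planar m n) ∎
  where open ≡-Reasoning

equilateral⇒rotation : ∀ A B → InPlane A → InPlane B → Equilateral O A B →
                       B ≡ rotate A ⊎ A ≡ rotate B
equilateral⇒rotation A B A∈ B∈ (OA≡OB , OA≡AB)
  with InPlane⇒planar A A∈ | InPlane⇒planar B B∈
... | m , n , refl | m′ , n′ , refl =
  Sum.map (norm≡0⇒rotation m n m′ n′) (norm≡0⇒rotation m′ n′ m n) (i*j≡0⇒i≡0∨j≡0 _ product≡0)
  where
  open ≡-Reasoning
  p : ℤ
  p = norm m n
  q≡p : norm m′ n′ ≡ p
  q≡p = *-cancelˡ-≡ (+ 2) _ _
    (trans (sym (dist²-O-planar m′ n′)) (trans (sym OA≡OB) (dist²-O-planar m n)))
  r≡p : norm (m - m′) (n - n′) ≡ p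
  r≡p = *-cancelˡ-≡ (+ 2) _ _
    (trans (sym (dist²-planar m n m′ n′)) (trans (sym OA≡AB) (dist²-O-planar m n)))
  product≡0 : norm (m′ - (m - n)) (n′ - m) * norm (m - (m′ - n′)) (n - m′) ≡ 0ℤ
  product≡0 = begin
    norm (m′ - (m - n)) (n′ - m) * norm (m - (m′ - n′)) (n - m′) ≡⟨ norm-rotation-identity m n m′ n′ ⟩
    sideDefect p (norm m′ n′) (norm (m - m′) (n - n′))            ≡⟨ cong₂ (sideDefect p) q≡p r≡p ⟩
    sideDefect p p p                                              ≡⟨ sideDefect-equal p ⟩
    0ℤ                                                            ∎

theorem4p2 : (A B : Point) → InPlane A → InPlane B → A ≢ O → Equilateral O A B →
    ∃₂ λ (m n : ℤ) →
      ((A ≡ ⟨ m , - n , n - m ⟩ × B ≡ ⟨ m - n , - m , n ⟩)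
        ⊎ (A ≡ ⟨ m - n , - m , n ⟩ × B ≡ ⟨ m , - n , n - m ⟩))
      × dist² O A ≡ + 2 * (m * m - m * n + n * n)
theorem4p2 A B A∈ B∈ _ equilateral
  with InPlane⇒planar A A∈ | InPlane⇒planar B B∈ | equilateral⇒rotation A B A∈ B∈ equilateral
... | m , n , refl | _ | inj₁ B≡ρA =
  m , n , inj₁ (refl , trans B≡ρA (rotate-planar m n)) , dist²-O-planar m n
... | _ | m , n , refl | inj₂ A≡ρB =
  m , n , inj₂ (trans A≡ρB (rotate-planar m n) , refl) ,
  trans (proj₁ equilateral) (dist²-O-planar m n)
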